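{- Let $q$ be a power of an odd prime with $q\equiv 3\pmod 4$, let $u\in\mathbb{F}_q\setminus\{0,\pm1\}$ with $\eta(1+u)=\eta(u)$, and $F_{2,u}(x)=x^2\big(1+u\eta(x)\big)$. For $b\in\mathbb{F}_q$, if $\#A_{10}(b)=2$ then $\#A_{00}(b)=0$.
   Context: $\eta$ is the quadratic character of $\mathbb{F}_q$ ($\eta(0)=0$, $\eta=1$ on nonzero squares, $-1$ on non-squares). $C_{00}=\{x:\eta(x)=\eta(x+1)=1\}$, $C_{10}=\{x:\eta(x)=-1,\eta(x+1)=1\}$, and $A_{ij}(b)=\{x\in C_{ij}: F_{2,u}(x+1)-F_{2,u}(x)=b\}$. -}

module Defs where

open import Level using (0ℓ)
open import Data.Nat using (ℕ; zero; suc)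
open import Data.Fin using (Fin)
open import Data.Fin.Properties using () renaming (_≟_ to _≟ᶠ_)
open import Data.List using (List; map; filter; length; allFin)
open import Data.List.Relation.Unary.Any using (Any; any?)
open import Data.Integer as ℤ using (ℤ; +_; -[1+_]; 0ℤ; 1ℤ; -1ℤ)
open import Data.Product using (∃; _×_; _,_; proj₁)
open import Data.Product.Relation.Binary.Pointwise.NonDependent using ()
open import Relation.Nullary using (Dec; yes; no; ¬_)
open import Relation.Nullary.Decidable using (_×-dec_; map′)
open import Relation.Binary.PropositionalEquality
open import Relation.Binary.Definitions using (DecidableEquality)
open import Algebra.Structures using (IsCommutativeRing)
open import Function.Bundles using (_↔_; Inverse)

record FiniteField (q : ℕ) : Set₁ where
  infixl 6 _+_ _-_
  infixl 7 _*_
  field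
    Carrier : Set
    _+_ _*_ : Carrier → Carrier → Carrier
    -_ : Carrier → Carrier
    0# 1# : Carrier
    isCommutativeRing : IsCommutativeRing _≡_ _+_ _*_ -_ 0# 1#
    0≢1 : ¬ (0# ≡ 1#)
    inverse : ∀ x → ¬ (x ≡ 0#) → ∃ λ y → x * y ≡ 1#
    enum : Fin q ↔ Carrier

  _-_ : Carrier → Carrier → Carrier
  x - y = x + (- y)

  _≟_ : DecidableEquality Carrier
  x ≟ y = map′ (λ e → trans (sym (Inverse.strictlyInverseˡ enum x))
                         (trans (cong (Inverse.to enum) e) (Inverse.strictlyInverseˡ enum y)))
               (cong (Inverse.from enum))
               (Inverse.from enum x ≟ᶠ Inverse.from enum y)

  elements : List Carrier
  elements = map (Inverse.to enum) (allFin q)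

  IsSquare : Carrier → Set
  IsSquare x = Any (λ y → y * y ≡ x) elements

  isSquare? : ∀ x → Dec (IsSquare x)
  isSquare? x = any? (λ y → (y * y) ≟ x) elements

  η : Carrier → ℤ
  η x with x ≟ 0#
  ... | yes _ = 0ℤ
  ... | no _ with isSquare? x
  ...   | yes _ = 1ℤ
  ...   | no _ = -1ℤ

  ⟦_⟧ℕ : ℕ → Carrier
  ⟦ zero ⟧ℕ = 0#
  ⟦ suc n ⟧ℕ = 1# + ⟦ n ⟧ℕ

  ⟦_⟧ : ℤ → Carrier
  ⟦ + n ⟧ = ⟦ n ⟧ℕ
  ⟦ -[1+ n ] ⟧ = - ⟦ suc n ⟧ℕ

  F2 : Carrier → Carrier → Carrier
  F2 u x = x * x * (1# + u * ⟦ η x ⟧)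

  A : Carrier → ℤ → ℤ → Carrier → List Carrier
  A u i j b = filter (λ x → (η x ℤ.≟ i) ×-dec ((η (x + 1#) ℤ.≟ j)
                         ×-dec ((F2 u (x + 1#) - F2 u x) ≟ b))) elements

  #A : Carrier → ℤ → ℤ → Carrier → ℕ
  #A u i j b = length (A u i j b)

-- Suppose x₁ ≠ x₂ lie in A₁₀(b) and x₀ in A₀₀(b). On these sets F_{2,u}(x+1) − F_{2,u}(x) equals
-- 2ux² + 2(1+u)x + (1+u) and (1+u)(2x+1) respectively, and eliminating b from the three equations
-- gives u·x₁x₂ + (1+u)·x₀ = 0. But x₁x₂ is a product of two non-squares, while x₀ and u(1+u) are
-- non-zero squares (the latter because η(1+u) = η(u)), so −1 = u²x₁x₂ / (u(1+u)x₀) would be a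
-- square, which is impossible when q ≡ 3 (mod 4).
-- The field is only known through an enumeration of its q elements, so the facts about squares
-- used here (2 ≠ 0, half of the non-zero elements are squares, −1 is not, a product of two
-- non-squares is) are obtained by counting with injections and fixed-point-free involutions.

module Submission where

open import Defs
open import Data.Nat using (ℕ; _^_; _%_; _≥_)
open import Data.Nat.Primality using (Prime)
open import Data.Integer using (1ℤ; -1ℤ)
open import Data.Product using (∃; ∃₂; _×_)
open import Relation.Nullary using (¬_)
open import Relation.Binary.PropositionalEquality using (_≡_)

open import Level using (0ℓ)
open import Function using (id; _∘_; _$_)
open import Function.Bundles using (Inverse; Injection)
open import Function.Properties.Inverse using (↔⇒↣; ↔-sym)
open import Data.Unit using (tt)
open import Data.Sum using (_⊎_; inj₁; inj₂)
open import Data.Product using (_,_; proj₁; proj₂)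
open import Data.Maybe using (Maybe; just; nothing)
open import Data.Nat as ℕ using (zero; suc; z≤n; s≤s)
import Data.Nat.Properties as ℕ
open import Data.Nat.DivMod using (m∣n⇒o%n%m≡o%m; m*n%n≡0; [m+kn]%n≡m%n)
open import Data.Nat.Divisibility using (divides)
open import Data.Nat.Tactic.RingSolver using (solve-∀)
open import Data.Integer as ℤ using (ℤ; -[1+_]; _⊖_)
import Data.Integer.Properties as ℤ
open import Data.Fin using (toℕ)
open import Data.Fin.Properties using (toℕ-injective)
open import Data.List using (List; []; _∷_; length; filter; map; allFin)
import Data.List.Properties as LP
open import Data.List.Relation.Unary.All as All using (All; []; _∷_)
import Data.List.Relation.Unary.All.Properties as AllP
open import Data.List.Relation.Unary.Any as Any using (Any; here; there; any?; _─_)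
open import Data.List.Relation.Unary.AllPairs using ([]; _∷_)
open import Data.List.Relation.Unary.Unique.Propositional using (Unique)
import Data.List.Relation.Unary.Unique.Propositional.Properties as UP
open import Data.List.Membership.Propositional using (_∈_; lose)
import Data.List.Membership.Propositional.Properties as MP
open import Data.List.Relation.Binary.Subset.Propositional using (_⊆_)
open import Relation.Nullary using (Dec; yes; no; ¬?; _×-dec_; contradiction)
open import Relation.Unary using (Pred; Decidable)
open import Relation.Unary.Properties using (_∩?_; ∁?; U?)
open import Relation.Binary.PropositionalEquality
  using (_≢_; refl; sym; trans; cong; cong₂; subst; module ≡-Reasoning)
open import Algebra.Bundles using (CommutativeRing)
open import Algebra.Solver.Ring.AlmostCommutativeRing
  using (fromCommutativeRing; _-Raw-AlmostCommutative⟶_)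

module ℤ-Coefficients {c ℓ} (R : CommutativeRing c ℓ) where
  open CommutativeRing R hiding (refl; sym; trans)
  open CommutativeRing R using () renaming (refl to ≈-refl; sym to ≈-sym; trans to ≈-trans)
  open import Algebra.Properties.Ring ring using (-‿distribˡ-*; -‿distribʳ-*; -‿involutive; -0#≈0#)
  open import Algebra.Properties.AbelianGroup +-abelianGroup using (⁻¹-∙-comm)
  open import Relation.Binary.Reasoning.Setoid setoid

  -- 1 is sent to 1# on the nose, so that the solver's constant 1 is literally 1#.
  fromℕ : ℕ → Carrier
  fromℕ zero = 0#
  fromℕ (suc zero) = 1#
  fromℕ (suc n@(suc _)) = 1# + fromℕ n

  fromℤ : ℤ → Carrier
  fromℤ (ℤ.+ n) = fromℕ n
  fromℤ -[1+ n ] = - fromℕ (suc n)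

  fromℕ-suc : ∀ n → fromℕ (suc n) ≈ 1# + fromℕ n
  fromℕ-suc zero = ≈-sym (+-identityʳ 1#)
  fromℕ-suc (suc n) = ≈-refl

  fromℕ-+ : ∀ m n → fromℕ (m ℕ.+ n) ≈ fromℕ m + fromℕ n
  fromℕ-+ zero n = ≈-sym (+-identityˡ _)
  fromℕ-+ (suc m) n = begin
    fromℕ (suc (m ℕ.+ n))      ≈⟨ fromℕ-suc (m ℕ.+ n) ⟩
    1# + fromℕ (m ℕ.+ n)       ≈⟨ +-congˡ (fromℕ-+ m n) ⟩
    1# + (fromℕ m + fromℕ n)   ≈⟨ +-assoc _ _ _ ⟨
    (1# + fromℕ m) + fromℕ n   ≈⟨ +-congʳ (fromℕ-suc m) ⟨
    fromℕ (suc m) + fromℕ n    ∎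

  fromℕ-* : ∀ m n → fromℕ (m ℕ.* n) ≈ fromℕ m * fromℕ n
  fromℕ-* zero n = ≈-sym (zeroˡ _)
  fromℕ-* (suc m) n = begin
    fromℕ (n ℕ.+ m ℕ.* n)               ≈⟨ fromℕ-+ n (m ℕ.* n) ⟩
    fromℕ n + fromℕ (m ℕ.* n)           ≈⟨ +-cong (*-identityˡ _) (≈-sym (fromℕ-* m n)) ⟨
    1# * fromℕ n + fromℕ m * fromℕ n    ≈⟨ distribʳ _ _ _ ⟨
    (1# + fromℕ m) * fromℕ n            ≈⟨ *-congʳ (fromℕ-suc m) ⟨
    fromℕ (suc m) * fromℕ n             ∎

  fromℤ-⊖ : ∀ m n → fromℤ (m ⊖ n) ≈ fromℕ m - fromℕ n
  fromℤ-⊖ zero zero = ≈-sym (-‿inverseʳ 0#)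
  fromℤ-⊖ zero (suc n) = ≈-sym (+-identityˡ _)
  fromℤ-⊖ (suc m) zero = ≈-sym (≈-trans (+-congˡ -0#≈0#) (+-identityʳ _))
  fromℤ-⊖ (suc m) (suc n) = begin
    fromℤ (suc m ⊖ suc n)                 ≡⟨ cong fromℤ (ℤ.[1+m]⊖[1+n]≡m⊖n m n) ⟩
    fromℤ (m ⊖ n)                         ≈⟨ fromℤ-⊖ m n ⟩
    fromℕ m - fromℕ n                     ≈⟨ +-congʳ (+-identityˡ _) ⟨
    (0# + fromℕ m) - fromℕ n              ≈⟨ +-congʳ (+-congʳ (-‿inverseʳ 1#)) ⟨
    ((1# - 1#) + fromℕ m) - fromℕ n       ≈⟨ +-assoc _ _ _ ⟩
    (1# - 1#) + (fromℕ m - fromℕ n)       ≈⟨ +-assoc _ _ _ ⟩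
    1# + (- 1# + (fromℕ m - fromℕ n))     ≈⟨ +-congˡ (+-comm _ _) ⟩
    1# + ((fromℕ m - fromℕ n) - 1#)       ≈⟨ +-congˡ (+-assoc _ _ _) ⟩
    1# + (fromℕ m + (- fromℕ n - 1#))     ≈⟨ +-assoc _ _ _ ⟨
    (1# + fromℕ m) + (- fromℕ n - 1#)     ≈⟨ +-cong (fromℕ-suc m) (≈-trans (≈-sym (⁻¹-∙-comm _ _)) (+-comm _ _)) ⟨
    fromℕ (suc m) - (1# + fromℕ n)        ≈⟨ +-congˡ (-‿cong (fromℕ-suc n)) ⟨
    fromℕ (suc m) - fromℕ (suc n)         ∎

  fromℤ-neg : ∀ z → fromℤ (ℤ.- z) ≈ - fromℤ z
  fromℤ-neg -[1+ n ] = ≈-sym (-‿involutive _)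
  fromℤ-neg (ℤ.+ zero) = ≈-sym -0#≈0#
  fromℤ-neg (ℤ.+ suc n) = ≈-refl

  fromℤ-+ : ∀ a b → fromℤ (a ℤ.+ b) ≈ fromℤ a + fromℤ b
  fromℤ-+ -[1+ m ] -[1+ n ] = begin
    - fromℕ (suc (suc (m ℕ.+ n)))         ≡⟨ cong (λ k → - fromℕ (suc k)) (ℕ.+-suc m n) ⟨
    - fromℕ (suc m ℕ.+ suc n)             ≈⟨ -‿cong (fromℕ-+ (suc m) (suc n)) ⟩
    - (fromℕ (suc m) + fromℕ (suc n))     ≈⟨ ⁻¹-∙-comm _ _ ⟨
    - fromℕ (suc m) + - fromℕ (suc n)     ∎
  fromℤ-+ -[1+ m ] (ℤ.+ n) = ≈-trans (fromℤ-⊖ n (suc m)) (+-comm _ _)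
  fromℤ-+ (ℤ.+ m) -[1+ n ] = fromℤ-⊖ m (suc n)
  fromℤ-+ (ℤ.+ m) (ℤ.+ n) = fromℕ-+ m n

  fromℤ-*⁺ : ∀ a n → fromℤ (a ℤ.* ℤ.+ n) ≈ fromℤ a * fromℕ n
  fromℤ-*⁺ (ℤ.+ m) n = ≈-trans (reflexive (cong fromℤ (sym (ℤ.pos-* m n)))) (fromℕ-* m n)
  fromℤ-*⁺ -[1+ m ] n = begin
    fromℤ (-[1+ m ] ℤ.* ℤ.+ n)            ≡⟨ cong fromℤ (ℤ.neg-distribˡ-* (ℤ.+ suc m) (ℤ.+ n)) ⟨
    fromℤ (ℤ.- (ℤ.+ suc m ℤ.* ℤ.+ n))     ≈⟨ fromℤ-neg (ℤ.+ suc m ℤ.* ℤ.+ n) ⟩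
    - fromℤ (ℤ.+ suc m ℤ.* ℤ.+ n)         ≈⟨ -‿cong (fromℤ-*⁺ (ℤ.+ suc m) n) ⟩
    - (fromℕ (suc m) * fromℕ n)           ≈⟨ -‿distribˡ-* _ _ ⟩
    - fromℕ (suc m) * fromℕ n             ∎

  fromℤ-* : ∀ a b → fromℤ (a ℤ.* b) ≈ fromℤ a * fromℤ b
  fromℤ-* a (ℤ.+ n) = fromℤ-*⁺ a n
  fromℤ-* a -[1+ n ] = begin
    fromℤ (a ℤ.* -[1+ n ])                ≡⟨ cong fromℤ (ℤ.neg-distribʳ-* a (ℤ.+ suc n)) ⟨
    fromℤ (ℤ.- (a ℤ.* ℤ.+ suc n))         ≈⟨ fromℤ-neg (a ℤ.* ℤ.+ suc n) ⟩
    - fromℤ (a ℤ.* ℤ.+ suc n)             ≈⟨ -‿cong (fromℤ-*⁺ a (suc n)) ⟩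
    - (fromℤ a * fromℕ (suc n))           ≈⟨ -‿distribʳ-* _ _ ⟩
    fromℤ a * - fromℕ (suc n)             ∎

  fromℤ-homomorphism : ℤ.+-*-rawRing -Raw-AlmostCommutative⟶ fromCommutativeRing R
  fromℤ-homomorphism = record
    { ⟦_⟧ = fromℤ ; +-homo = fromℤ-+ ; *-homo = fromℤ-* ; -‿homo = fromℤ-neg
    ; 0-homo = ≈-refl ; 1-homo = ≈-refl }

  fromℤ-≟ : ∀ a b → Maybe (fromℤ a ≈ fromℤ b)
  fromℤ-≟ a b with a ℤ.≟ b
  ... | yes refl = just ≈-refl
  ... | no _ = nothing

  open import Algebra.Solver.Ring ℤ.+-*-rawRing (fromCommutativeRing R) fromℤ-homomorphism fromℤ-≟ public

module _ {a} {A : Set a} where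

  ∈-─⁺ : ∀ {x y} {ys : List A} (x∈ys : x ∈ ys) → y ∈ ys → x ≢ y → y ∈ (ys ─ x∈ys)
  ∈-─⁺ (here refl) (here refl) x≢y = contradiction refl x≢y
  ∈-─⁺ (here _) (there y∈ys) _ = y∈ys
  ∈-─⁺ (there _) (here y≡z) _ = here y≡z
  ∈-─⁺ (there x∈ys) (there y∈ys) x≢y = there (∈-─⁺ x∈ys y∈ys x≢y)

  unique-⊆⇒length≤ : ∀ {xs ys : List A} → Unique xs → xs ⊆ ys → length xs ℕ.≤ length ys
  unique-⊆⇒length≤ [] _ = z≤n
  unique-⊆⇒length≤ {x ∷ xs} {ys} (x∉xs ∷ xs!) xs⊆ys = begin
    suc (length xs)             ≤⟨ s≤s (unique-⊆⇒length≤ xs! xs⊆ys─x) ⟩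
    suc (length (ys ─ x∈ys))    ≡⟨ LP.length-removeAt′ ys _ ⟨
    length ys                   ∎
    where
    open ℕ.≤-Reasoning
    x∈ys : x ∈ ys
    x∈ys = xs⊆ys (here refl)
    xs⊆ys─x : xs ⊆ (ys ─ x∈ys)
    xs⊆ys─x y∈xs = ∈-─⁺ x∈ys (xs⊆ys (there y∈xs)) (All.lookup x∉xs y∈xs)

  unique-map⁺ : ∀ {b p} {B : Set b} {P : Pred A p} {f : A → B} → (∀ {x y} → P x → P y → f x ≡ f y → x ≡ y) →
                ∀ {xs} → All P xs → Unique xs → Unique (map f xs)
  unique-map⁺ f-inj [] [] = []
  unique-map⁺ f-inj (px ∷ pxs) (x∉xs ∷ xs!) =
    AllP.map⁺ (All.zipWith (λ (py , x≢y) fx≡fy → x≢y (f-inj px py fx≡fy)) (pxs , x∉xs))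
    ∷ unique-map⁺ f-inj pxs xs!

  length-filter-∩-∁ : ∀ {p r} {P : Pred A p} {Q : Pred A r} (P? : Decidable P) (Q? : Decidable Q) xs →
    length (filter P? xs) ≡ length (filter (P? ∩? Q?) xs) ℕ.+ length (filter (P? ∩? ∁? Q?) xs)
  length-filter-∩-∁ P? Q? [] = refl
  length-filter-∩-∁ P? Q? (x ∷ xs) with P? x | Q? x
  ... | yes _ | yes _ = cong suc (length-filter-∩-∁ P? Q? xs)
  ... | yes _ | no _ = trans (cong suc (length-filter-∩-∁ P? Q? xs)) (sym (ℕ.+-suc _ _))
  ... | no _ | _ = length-filter-∩-∁ P? Q? xs

length≡2⇒distinct-members : ∀ {a} {A : Set a} {xs : List A} → Unique xs → length xs ≡ 2 →
                            ∃₂ λ x y → x ∈ xs × y ∈ xs × x ≢ y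
length≡2⇒distinct-members {xs = x ∷ y ∷ []} ((x≢y ∷ []) ∷ _) _ = x , y , here refl , there (here refl) , x≢y

module _ {q : ℕ} (q%4≡3 : q % 4 ≡ 3) where

  q≢n+n : ∀ n → q ≢ n ℕ.+ n
  q≢n+n n q≡n+n = ℕ.1+n≢0 $ begin
    1                 ≡⟨ cong (_% 2) q%4≡3 ⟨
    q % 4 % 2         ≡⟨ m∣n⇒o%n%m≡o%m 2 4 q (divides 2 refl) ⟩
    q % 2             ≡⟨ cong (_% 2) (trans q≡n+n (n+n≡n*2 n)) ⟩
    (n ℕ.* 2) % 2     ≡⟨ m*n%n≡0 n 2 ⟩
    0                 ∎
    where
    open ≡-Reasoning
    n+n≡n*2 : ∀ n → n ℕ.+ n ≡ n ℕ.* 2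
    n+n≡n*2 = solve-∀

  q≢4n+1 : ∀ n → q ≢ (n ℕ.+ n) ℕ.+ (n ℕ.+ n) ℕ.+ 1
  q≢4n+1 n q≡4n+1 = (λ ()) $ begin
    3                 ≡⟨ q%4≡3 ⟨
    q % 4             ≡⟨ cong (_% 4) (trans q≡4n+1 (4n+1≡1+n*4 n)) ⟩
    (1 ℕ.+ n ℕ.* 4) % 4 ≡⟨ [m+kn]%n≡m%n 1 n 4 ⟩
    1                 ∎
    where
    open ≡-Reasoning
    4n+1≡1+n*4 : ∀ n → (n ℕ.+ n) ℕ.+ (n ℕ.+ n) ℕ.+ 1 ≡ 1 ℕ.+ n ℕ.* 4
    4n+1≡1+n*4 = solve-∀

module FiniteFieldProperties {q : ℕ} (F : FiniteField q) where
  open FiniteField F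

  commutativeRing : CommutativeRing 0ℓ 0ℓ
  commutativeRing = record { isCommutativeRing = isCommutativeRing }

  open CommutativeRing commutativeRing
    using (+-identityˡ; +-identityʳ; *-identityˡ; zeroˡ; zeroʳ; -‿inverseʳ; +-assoc)
  open import Algebra.Properties.Ring (CommutativeRing.ring commutativeRing)
    using (-‿involutive; -0#≈0#; -1*x≈-x)
  open ℤ-Coefficients commutativeRing using (fromℕ; fromℕ-suc; fromℤ)
  open ℤ-Coefficients commutativeRing public
    using (solve; Polynomial; _:+_; _:*_; _:-_; :-_; _:=_; con)

  x-y≡0⇒x≡y : ∀ {x y} → x - y ≡ 0# → x ≡ y
  x-y≡0⇒x≡y {x} {y} x-y≡0 = begin
    x              ≡⟨ solve 2 (λ x y → x := (x :- y) :+ y) refl x y ⟩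
    (x - y) + y    ≡⟨ cong (_+ y) x-y≡0 ⟩
    0# + y         ≡⟨ +-identityˡ y ⟩
    y              ∎
    where open ≡-Reasoning

  x*y≡0⇒y≡0 : ∀ {x y} → x ≢ 0# → x * y ≡ 0# → y ≡ 0#
  x*y≡0⇒y≡0 {x} {y} x≢0 xy≡0 with x⁻¹ , xx⁻¹≡1 ← inverse x x≢0 = begin
    y                ≡⟨ *-identityˡ y ⟨
    1# * y           ≡⟨ cong (_* y) xx⁻¹≡1 ⟨
    (x * x⁻¹) * y    ≡⟨ solve 3 (λ x x⁻¹ y → (x :* x⁻¹) :* y := x⁻¹ :* (x :* y)) refl x x⁻¹ y ⟩
    x⁻¹ * (x * y)    ≡⟨ cong (x⁻¹ *_) xy≡0 ⟩
    x⁻¹ * 0#         ≡⟨ zeroʳ x⁻¹ ⟩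
    0#               ∎
    where open ≡-Reasoning

  *-cancelˡ : ∀ {x y z} → x ≢ 0# → x * y ≡ x * z → y ≡ z
  *-cancelˡ {x} {y} {z} x≢0 xy≡xz = x-y≡0⇒x≡y (x*y≡0⇒y≡0 x≢0 (begin
    x * (y - z)     ≡⟨ solve 3 (λ x y z → x :* (y :- z) := x :* y :- x :* z) refl x y z ⟩
    x * y - x * z   ≡⟨ cong (_- x * z) xy≡xz ⟩
    x * z - x * z   ≡⟨ -‿inverseʳ (x * z) ⟩
    0#              ∎))
    where open ≡-Reasoning

  x²≡y²⇒x≡±y : ∀ {x y} → x * x ≡ y * y → x ≡ y ⊎ x ≡ - y
  x²≡y²⇒x≡±y {x} {y} x²≡y² with (x - y) ≟ 0#
  ... | yes x-y≡0 = inj₁ (x-y≡0⇒x≡y x-y≡0)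
  ... | no x-y≢0 = inj₂ (x-y≡0⇒x≡y (trans (cong (x +_) (-‿involutive y)) (x*y≡0⇒y≡0 x-y≢0 (begin
    (x - y) * (x + y)   ≡⟨ solve 2 (λ x y → (x :- y) :* (x :+ y) := x :* x :- y :* y) refl x y ⟩
    x * x - y * y       ≡⟨ cong (_- y * y) x²≡y² ⟩
    y * y - y * y       ≡⟨ -‿inverseʳ (y * y) ⟩
    0#                  ∎))))
    where open ≡-Reasoning

  x*y≢0 : ∀ {x y} → x ≢ 0# → y ≢ 0# → x * y ≢ 0#
  x*y≢0 x≢0 y≢0 xy≡0 = y≢0 (x*y≡0⇒y≡0 x≢0 xy≡0)

  -x≢0 : ∀ {x} → x ≢ 0# → - x ≢ 0#
  -x≢0 {x} x≢0 -x≡0 = x≢0 (trans (sym (-‿involutive x)) (trans (cong -_ -x≡0) -0#≈0#))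

  root≢0 : ∀ {r s} → s ≢ 0# → r * r ≡ s → r ≢ 0#
  root≢0 {r} s≢0 r²≡s r≡0 = s≢0 (trans (sym r²≡s) (trans (cong (_* r) r≡0) (zeroˡ r)))

  elements-complete : ∀ x → x ∈ elements
  elements-complete x = subst (_∈ elements) (Inverse.strictlyInverseˡ enum x)
                                (MP.∈-map⁺ (Inverse.to enum) (MP.∈-allFin (Inverse.from enum x)))

  elements-unique : Unique elements
  elements-unique = UP.map⁺ (Injection.injective (↔⇒↣ enum)) (UP.allFin⁺ q)

  length-elements : length elements ≡ q
  length-elements = trans (LP.length-map (Inverse.to enum) (allFin q)) (LP.length-tabulate id)

  square-intro : ∀ y {x} → y * y ≡ x → IsSquare x
  square-intro y = lose (elements-complete y)

  square-* : ∀ {x y} → IsSquare x → IsSquare y → IsSquare (x * y)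
  square-* x-sq y-sq with r , r²≡x ← Any.satisfied x-sq | s , s²≡y ← Any.satisfied y-sq =
    square-intro (r * s) (trans (solve 2 (λ r s → (r :* s) :* (r :* s) := (r :* r) :* (s :* s)) refl r s)
                                  (cong₂ _*_ r²≡x s²≡y))

  square-÷ : ∀ {x y} → y ≢ 0# → IsSquare (x * y) → IsSquare y → IsSquare x
  square-÷ {x} {y} y≢0 xy-sq y-sq
    with r , r²≡xy ← Any.satisfied xy-sq | s , s²≡y ← Any.satisfied y-sq
    with s⁻¹ , ss⁻¹≡1 ← inverse s (root≢0 y≢0 s²≡y) =
    square-intro (r * s⁻¹) (begin
      (r * s⁻¹) * (r * s⁻¹)
        ≡⟨ solve 2 (λ r s⁻¹ → (r :* s⁻¹) :* (r :* s⁻¹) := (r :* r) :* (s⁻¹ :* s⁻¹)) refl r s⁻¹ ⟩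
      (r * r) * (s⁻¹ * s⁻¹)
        ≡⟨ cong (_* (s⁻¹ * s⁻¹)) (trans r²≡xy (cong (x *_) (sym s²≡y))) ⟩
      (x * (s * s)) * (s⁻¹ * s⁻¹)
        ≡⟨ solve 3 (λ x s s⁻¹ → (x :* (s :* s)) :* (s⁻¹ :* s⁻¹) := x :* ((s :* s⁻¹) :* (s :* s⁻¹))) refl x s s⁻¹ ⟩
      x * ((s * s⁻¹) * (s * s⁻¹))
        ≡⟨ cong (λ t → x * (t * t)) ss⁻¹≡1 ⟩
      x * (1# * 1#)
        ≡⟨ solve 1 (λ x → x :* (con 1ℤ :* con 1ℤ) := x) refl x ⟩
      x ∎)
    where open ≡-Reasoning

  count : ∀ {p} {P : Pred Carrier p} → Decidable P → ℕ
  count P? = length (filter P? elements)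

  module _ {p r} {P : Pred Carrier p} {Q : Pred Carrier r} (P? : Decidable P) (Q? : Decidable Q) where

    count-≤-injection : (f : Carrier → Carrier) → (∀ {x y} → P x → P y → f x ≡ f y → x ≡ y) →
                        (∀ {x} → P x → Q (f x)) → count P? ℕ.≤ count Q?
    count-≤-injection f f-inj f-maps = begin
      count P?                             ≡⟨ LP.length-map f (filter P? elements) ⟨
      length (map f (filter P? elements))  ≤⟨ unique-⊆⇒length≤ f[P]-unique f[P]⊆Q ⟩
      count Q?                             ∎
      where
      open ℕ.≤-Reasoning
      f[P]-unique : Unique (map f (filter P? elements))
      f[P]-unique = unique-map⁺ f-inj (AllP.all-filter P? elements) (UP.filter⁺ P? elements-unique)
      f[P]⊆Q : map f (filter P? elements) ⊆ filter Q? elements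
      f[P]⊆Q y∈f[P] with x , _ , refl , px ← MP.∈-map∘filter⁻ f P? {xs = elements} y∈f[P] =
        MP.∈-filter⁺ Q? (elements-complete (f x)) (f-maps px)

    count-∩-∁ : count P? ≡ count (P? ∩? Q?) ℕ.+ count (P? ∩? ∁? Q?)
    count-∩-∁ = length-filter-∩-∁ P? Q? elements

  module _ {p r} {P : Pred Carrier p} {Q : Pred Carrier r} (P? : Decidable P) (Q? : Decidable Q) where

    count-≤-surjection : (f : Carrier → Carrier) → (∀ {y} → Q y → ∃ λ x → P x × f x ≡ y) → count Q? ℕ.≤ count P?
    count-≤-surjection f f-onto =
      count-≤-injection Q? P? section
        (λ qx qy sx≡sy → trans (sym (proj₂ (section-spec qx))) (trans (cong f sx≡sy) (proj₂ (section-spec qy))))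
        (λ qy → proj₁ (section-spec qy))
      where
      preimage? : ∀ y → Dec (Any (λ x → P x × f x ≡ y) elements)
      preimage? y = any? (λ x → P? x ×-dec (f x ≟ y)) elements
      section : Carrier → Carrier
      section y with preimage? y
      ... | yes found = proj₁ (Any.satisfied found)
      ... | no _ = y
      section-spec : ∀ {y} → Q y → P (section y) × f (section y) ≡ y
      section-spec {y} qy with preimage? y
      ... | yes found = proj₂ (Any.satisfied found)
      ... | no none = contradiction (lose (elements-complete _) (proj₂ (f-onto qy))) none

  count-pos : ∀ {p} {P : Pred Carrier p} (P? : Decidable P) {x} → P x → 1 ℕ.≤ count P?
  count-pos P? px = LP.filter-some P? (lose (elements-complete _) px)

  count-U : count U? ≡ q
  count-U = trans (cong length (LP.filter-all U? (All.universal _ elements))) length-elements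

  ≢0? : Decidable (_≢ 0#)
  ≢0? x = ¬? (x ≟ 0#)

  count-singleton : ∀ {p} {P : Pred Carrier p} (P? : Decidable P) {a} → (∀ {x} → P x → x ≡ a) → P a → count P? ≡ 1
  count-singleton P? {a} P⇒≡a pa = ℕ.≤-antisym
    (unique-⊆⇒length≤ {ys = a ∷ []} (UP.filter⁺ P? elements-unique)
                      (λ x∈P → here (P⇒≡a (proj₂ (MP.∈-filter⁻ P? {xs = elements} x∈P)))))
    (count-pos P? pa)

  q≡#nonzero+1 : q ≡ count ≢0? ℕ.+ 1
  q≡#nonzero+1 = begin
    q                                              ≡⟨ count-U ⟨
    count U?                                       ≡⟨ count-∩-∁ U? (_≟ 0#) ⟩
    count (U? ∩? (_≟ 0#)) ℕ.+ count (U? ∩? ≢0?)    ≡⟨ cong₂ ℕ._+_ #zero≡1 #U∩nonzero≡#nonzero ⟩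
    1 ℕ.+ count ≢0?                                ≡⟨ ℕ.+-comm 1 _ ⟩
    count ≢0? ℕ.+ 1                                ∎
    where
    open ≡-Reasoning
    #zero≡1 : count (U? ∩? (_≟ 0#)) ≡ 1
    #zero≡1 = count-singleton (U? ∩? (_≟ 0#)) proj₂ (tt , refl)
    #U∩nonzero≡#nonzero : count (U? ∩? ≢0?) ≡ count ≢0?
    #U∩nonzero≡#nonzero = cong length (LP.filter-≐ (U? ∩? ≢0?) ≢0? (proj₂ , (tt ,_)) elements)

  -- Any strict total order would do: it picks one point out of each orbit of a fixed-point-free involution.
  infix 4 _≺_ _≺?_
  _≺_ : Carrier → Carrier → Set
  x ≺ y = toℕ (Inverse.from enum x) ℕ.< toℕ (Inverse.from enum y)

  _≺?_ : ∀ x y → Dec (x ≺ y)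
  x ≺? y = _ ℕ.<? _

  ≺-connex : ∀ {x y} → x ≢ y → ¬ x ≺ y → y ≺ x
  ≺-connex x≢y x⊀y = ℕ.≤∧≢⇒< (ℕ.≮⇒≥ x⊀y)
    (λ y≡x → x≢y (sym (Injection.injective (↔⇒↣ (↔-sym enum)) (toℕ-injective y≡x))))

  module _ {p} {P : Pred Carrier p} (P? : Decidable P) (σ : Carrier → Carrier) (σ-involutive : ∀ x → σ (σ x) ≡ x)
           (σ-preserves : ∀ {x} → P x → P (σ x)) (σ-fixes-none : ∀ {x} → P x → σ x ≢ x) where

    count-fixedPointFreeInvolution : count P? ≡ count (P? ∩? (λ x → x ≺? σ x)) ℕ.+ count (P? ∩? (λ x → x ≺? σ x))
    count-fixedPointFreeInvolution =
      trans (count-∩-∁ P? _) (cong (count (P? ∩? _) ℕ.+_) (ℕ.≤-antisym lower≤upper upper≤lower))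
      where
      σ-injective : ∀ {x y} → P x → P y → σ x ≡ σ y → x ≡ y
      σ-injective {x} {y} _ _ σx≡σy = trans (sym (σ-involutive x)) (trans (cong σ σx≡σy) (σ-involutive y))
      lower≤upper : count (P? ∩? ∁? (λ x → x ≺? σ x)) ℕ.≤ count (P? ∩? (λ x → x ≺? σ x))
      lower≤upper = count-≤-injection _ _ σ (λ (px , _) (py , _) → σ-injective px py)
        λ {x} (px , x⊀σx) → σ-preserves px , subst (σ x ≺_) (sym (σ-involutive x))
                                                      (≺-connex (λ x≡σx → σ-fixes-none px (sym x≡σx)) x⊀σx)
      upper≤lower : count (P? ∩? (λ x → x ≺? σ x)) ℕ.≤ count (P? ∩? ∁? (λ x → x ≺? σ x))
      upper≤lower = count-≤-injection _ _ σ (λ (px , _) (py , _) → σ-injective px py)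
        λ {x} (px , x≺σx) → σ-preserves px , λ σx≺σσx → ℕ.<-asym x≺σx (subst (σ x ≺_) (σ-involutive x) σx≺σσx)

  QR QNR : Carrier → Set
  QR x = x ≢ 0# × IsSquare x
  QNR x = x ≢ 0# × ¬ IsSquare x

  QR? : Decidable QR
  QR? = ≢0? ∩? isSquare?

  QNR? : Decidable QNR
  QNR? = ≢0? ∩? ∁? isSquare?

  QR⇒η≡1 : ∀ {x} → QR x → η x ≡ 1ℤ
  QR⇒η≡1 {x} (x≢0 , x-sq) with x ≟ 0#
  ... | yes x≡0 = contradiction x≡0 x≢0
  ... | no _ with isSquare? x
  ...   | yes _ = refl
  ...   | no x-nsq = contradiction x-sq x-nsq

  QNR⇒η≡-1 : ∀ {x} → QNR x → η x ≡ -1ℤ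
  QNR⇒η≡-1 {x} (x≢0 , x-nsq) with x ≟ 0#
  ... | yes x≡0 = contradiction x≡0 x≢0
  ... | no _ with isSquare? x
  ...   | yes x-sq = contradiction x-sq x-nsq
  ...   | no _ = refl

  η≡1⇒QR : ∀ {x} → η x ≡ 1ℤ → QR x
  η≡1⇒QR {x} ηx≡1 with x ≟ 0#
  ... | yes _ = contradiction ηx≡1 λ ()
  ... | no x≢0 with isSquare? x
  ...   | yes x-sq = x≢0 , x-sq
  ...   | no _ = contradiction ηx≡1 λ ()

  η≡-1⇒QNR : ∀ {x} → η x ≡ -1ℤ → QNR x
  η≡-1⇒QNR {x} ηx≡-1 with x ≟ 0#
  ... | yes _ = contradiction ηx≡-1 λ ()
  ... | no x≢0 with isSquare? x
  ...   | yes _ = contradiction ηx≡-1 λ ()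
  ...   | no x-nsq = x≢0 , x-nsq

  ⟦⟧ℕ≡fromℕ : ∀ n → ⟦ n ⟧ℕ ≡ fromℕ n
  ⟦⟧ℕ≡fromℕ zero = refl
  ⟦⟧ℕ≡fromℕ (suc n) = trans (cong (1# +_) (⟦⟧ℕ≡fromℕ n)) (sym (fromℕ-suc n))

  ⟦⟧≡fromℤ : ∀ z → ⟦ z ⟧ ≡ fromℤ z
  ⟦⟧≡fromℤ (ℤ.+ n) = ⟦⟧ℕ≡fromℕ n
  ⟦⟧≡fromℤ -[1+ n ] = cong -_ (⟦⟧ℕ≡fromℕ (suc n))

  F2-η : ∀ {u x i} → η x ≡ i → F2 u x ≡ x * x * (1# + u * fromℤ i)
  F2-η {u} {x} {i} ηx≡i = cong (λ c → x * x * (1# + u * c)) (trans (cong ⟦_⟧ ηx≡i) (⟦⟧≡fromℤ i))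

  InA : Carrier → ℤ → ℤ → Carrier → Carrier → Set
  InA u i j b x = η x ≡ i × η (x + 1#) ≡ j × F2 u (x + 1#) - F2 u x ≡ b

  InA? : ∀ u i j b → Decidable (InA u i j b)
  InA? u i j b x = (η x ℤ.≟ i) ×-dec ((η (x + 1#) ℤ.≟ j) ×-dec ((F2 u (x + 1#) - F2 u x) ≟ b))

  #A≡2⇒two-points : ∀ {u i j b} → #A u i j b ≡ 2 → ∃₂ λ x₁ x₂ → InA u i j b x₁ × InA u i j b x₂ × x₁ ≢ x₂
  #A≡2⇒two-points {u} {i} {j} {b} #A≡2
    with x₁ , x₂ , x₁∈A , x₂∈A , x₁≢x₂ ← length≡2⇒distinct-members (UP.filter⁺ (InA? u i j b) elements-unique) #A≡2 =
    x₁ , x₂ , ∈A⇒InA x₁∈A , ∈A⇒InA x₂∈A , x₁≢x₂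
    where
    ∈A⇒InA : ∀ {x} → x ∈ A u i j b → InA u i j b x
    ∈A⇒InA = proj₂ ∘ MP.∈-filter⁻ (InA? u i j b) {xs = elements}

  #A≡0 : ∀ {u i j b} → (∀ x → ¬ InA u i j b x) → #A u i j b ≡ 0
  #A≡0 {u} {i} {j} {b} empty = cong length (LP.filter-none (InA? u i j b) (All.universal empty elements))

  InA⇒increment : ∀ {u i j b x} → InA u i j b x →
                  (x + 1#) * (x + 1#) * (1# + u * fromℤ j) - x * x * (1# + u * fromℤ i) ≡ b
  InA⇒increment (ηx≡i , ηx+1≡j , F2-increment) = trans (cong₂ _-_ (sym (F2-η ηx+1≡j)) (sym (F2-η ηx≡i))) F2-increment

  relation⇒-1-square : ∀ {u a c} → IsSquare a → QR c → QR (u * (1# + u)) →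
                       u * a + (1# + u) * c ≡ 0# → IsSquare (- 1#)
  relation⇒-1-square {u} {a} {c} a-sq (c≢0 , c-sq) (w≢0 , w-sq) relation =
    square-÷ (x*y≢0 w≢0 c≢0) (subst IsSquare uua≡-wc (square-* (square-intro u refl) a-sq)) (square-* w-sq c-sq)
    where
    open ≡-Reasoning
    uua≡-wc : (u * u) * a ≡ - 1# * (u * (1# + u) * c)
    uua≡-wc = begin
      (u * u) * a
        ≡⟨ solve 3 (λ u a c → (u :* u) :* a
                              := con -1ℤ :* (u :* (con 1ℤ :+ u) :* c) :+ u :* (u :* a :+ (con 1ℤ :+ u) :* c))
                   refl u a c ⟩
      - 1# * (u * (1# + u) * c) + u * (u * a + (1# + u) * c)
        ≡⟨ cong (λ r → - 1# * (u * (1# + u) * c) + u * r) relation ⟩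
      - 1# * (u * (1# + u) * c) + u * 0#
        ≡⟨ trans (cong (_ +_) (zeroʳ u)) (+-identityʳ _) ⟩
      - 1# * (u * (1# + u) * c)
        ∎

  module _ (q%4≡3 : q % 4 ≡ 3) where

    1+1≢0 : 1# + 1# ≢ 0#
    1+1≢0 2≡0 = q≢n+n q%4≡3 (count (U? ∩? λ x → x ≺? (x + 1#))) (trans (sym count-U)
      (count-fixedPointFreeInvolution U? (_+ 1#) x+1+1≡x _ (λ {x} _ → x+1≢x x)))
      where
      x+1+1≡x : ∀ x → (x + 1#) + 1# ≡ x
      x+1+1≡x x = trans (+-assoc x 1# 1#) (trans (cong (x +_) 2≡0) (+-identityʳ x))
      x+1≢x : ∀ x → x + 1# ≢ x
      x+1≢x x x+1≡x = 0≢1 (sym (begin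
        1#              ≡⟨ solve 1 (λ x → con 1ℤ := (x :+ con 1ℤ) :- x) refl x ⟩
        (x + 1#) - x    ≡⟨ cong (_- x) x+1≡x ⟩
        x - x           ≡⟨ -‿inverseʳ x ⟩
        0#              ∎))
        where open ≡-Reasoning

    -x≢x : ∀ {x} → x ≢ 0# → - x ≢ x
    -x≢x {x} x≢0 -x≡x = x≢0 (x*y≡0⇒y≡0 1+1≢0 (begin
      (1# + 1#) * x   ≡⟨ solve 1 (λ x → (con 1ℤ :+ con 1ℤ) :* x := x :+ x) refl x ⟩
      x + x           ≡⟨ cong (x +_) -x≡x ⟨
      x - x           ≡⟨ -‿inverseʳ x ⟩
      0#              ∎))
      where open ≡-Reasoning

    #nonzero≡#QR+#QR : count ≢0? ≡ count QR? ℕ.+ count QR?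
    #nonzero≡#QR+#QR =
      trans (count-fixedPointFreeInvolution ≢0? -_ -‿involutive -x≢0 -x≢x) (cong (λ n → n ℕ.+ n) #H≡#QR)
      where
      -- Squaring is a bijection from H, which holds one of x and -x for each x ≢ 0, onto the non-zero squares.
      H : Carrier → Set
      H x = x ≢ 0# × x ≺ - x
      H? : Decidable H
      H? = ≢0? ∩? (λ x → x ≺? - x)
      square-injective : ∀ {x y} → H x → H y → x * x ≡ y * y → x ≡ y
      square-injective {x} {y} (_ , x≺-x) (_ , y≺-y) x²≡y² with x²≡y²⇒x≡±y x²≡y²
      ... | inj₁ x≡y = x≡y
      ... | inj₂ refl = contradiction y≺-y (ℕ.<-asym (subst (- y ≺_) (-‿involutive y) x≺-x))
      H-or-H-neg : ∀ {r} → r ≢ 0# → H r ⊎ H (- r)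
      H-or-H-neg {r} r≢0 with r ≺? - r
      ... | yes r≺-r = inj₁ (r≢0 , r≺-r)
      ... | no r⊀-r = inj₂ (-x≢0 r≢0 , subst (- r ≺_) (sym (-‿involutive r)) (≺-connex (-x≢x r≢0 ∘ sym) r⊀-r))
      square-onto : ∀ {s} → QR s → ∃ λ x → H x × x * x ≡ s
      square-onto (s≢0 , s-sq) with r , r²≡s ← Any.satisfied s-sq with H-or-H-neg (root≢0 s≢0 r²≡s)
      ... | inj₁ Hr = r , Hr , r²≡s
      ... | inj₂ H-r = - r , H-r , trans (solve 1 (λ r → (:- r) :* (:- r) := r :* r) refl r) r²≡s
      #H≡#QR : count H? ≡ count QR?
      #H≡#QR = ℕ.≤-antisym
        (count-≤-injection H? QR? (λ x → x * x) square-injective λ {x} (x≢0 , _) → x*y≢0 x≢0 x≢0 , square-intro x refl)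
        (count-≤-surjection H? QR? (λ x → x * x) square-onto)

    #QR≡#QNR : count QR? ≡ count QNR?
    #QR≡#QNR = ℕ.+-cancelˡ-≡ (count QR?) _ _ (trans (sym #nonzero≡#QR+#QR) (count-∩-∁ ≢0? isSquare?))

    -1-nonsquare : ¬ IsSquare (- 1#)
    -1-nonsquare -1-sq = q≢4n+1 q%4≡3 t (begin
      q                                  ≡⟨ q≡#nonzero+1 ⟩
      count ≢0? ℕ.+ 1                    ≡⟨ cong (ℕ._+ 1) #nonzero≡#QR+#QR ⟩
      count QR? ℕ.+ count QR? ℕ.+ 1      ≡⟨ cong (λ n → n ℕ.+ n ℕ.+ 1) #QR≡t+t ⟩
      (t ℕ.+ t) ℕ.+ (t ℕ.+ t) ℕ.+ 1      ∎)
      where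
      open ≡-Reasoning
      -x-QR : ∀ {x} → QR x → QR (- x)
      -x-QR {x} (x≢0 , x-sq) = -x≢0 x≢0 , subst IsSquare (-1*x≈-x x) (square-* -1-sq x-sq)
      t : ℕ
      t = count (QR? ∩? λ x → x ≺? - x)
      #QR≡t+t : count QR? ≡ t ℕ.+ t
      #QR≡t+t = count-fixedPointFreeInvolution QR? -_ -‿involutive -x-QR (λ (x≢0 , _) → -x≢x x≢0)

    QNR*QNR-square : ∀ {x y} → QNR x → QNR y → IsSquare (x * y)
    QNR*QNR-square {x} {y} (x≢0 , x-nsq) (y≢0 , y-nsq) with isSquare? (x * y)
    ... | yes xy-sq = xy-sq
    -- Otherwise x *_ would inject the non-zero squares into the non-squares other than y.
    ... | no xy-nsq = contradiction (begin-strict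
      count QR?
        ≤⟨ count-≤-injection QR? (QNR? ∩? ∁? (_≟ y)) (x *_) x*-injective x*-maps ⟩
      count (QNR? ∩? ∁? (_≟ y))
        <⟨ ℕ.m<n+m _ (count-pos (QNR? ∩? (_≟ y)) ((y≢0 , y-nsq) , refl)) ⟩
      count (QNR? ∩? (_≟ y)) ℕ.+ count (QNR? ∩? ∁? (_≟ y))
        ≡⟨ count-∩-∁ QNR? (_≟ y) ⟨
      count QNR?
        ≡⟨ #QR≡#QNR ⟨
      count QR? ∎) (ℕ.<-irrefl refl)
      where
      open ℕ.≤-Reasoning
      x*-injective : ∀ {a b} → QR a → QR b → x * a ≡ x * b → a ≡ b
      x*-injective _ _ = *-cancelˡ x≢0
      x*-maps : ∀ {a} → QR a → QNR (x * a) × x * a ≢ y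
      x*-maps {a} (a≢0 , a-sq) = (x*y≢0 x≢0 a≢0 , λ xa-sq → x-nsq (square-÷ a≢0 xa-sq a-sq))
                               , λ xa≡y → xy-nsq (subst IsSquare (xxa≡xy xa≡y) (square-* (square-intro x refl) a-sq))
        where
        xxa≡xy : x * a ≡ y → (x * x) * a ≡ x * y
        xxa≡xy xa≡y = trans (solve 2 (λ x a → (x :* x) :* a := x :* (x :* a)) refl x a) (cong (x *_) xa≡y)

    η≡⇒square : ∀ {x y} → x ≢ 0# → y ≢ 0# → η x ≡ η y → IsSquare (x * y)
    η≡⇒square {x} {y} x≢0 y≢0 ηx≡ηy with isSquare? x | isSquare? y
    ... | yes x-sq | yes y-sq = square-* x-sq y-sq
    ... | no x-nsq | no y-nsq = QNR*QNR-square (x≢0 , x-nsq) (y≢0 , y-nsq)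
    ... | yes x-sq | no y-nsq =
      contradiction (trans (sym (QR⇒η≡1 (x≢0 , x-sq))) (trans ηx≡ηy (QNR⇒η≡-1 (y≢0 , y-nsq)))) λ ()
    ... | no x-nsq | yes y-sq =
      contradiction (trans (sym (QNR⇒η≡-1 (x≢0 , x-nsq))) (trans ηx≡ηy (QR⇒η≡1 (y≢0 , y-sq)))) λ ()

    A₁₀-A₀₀-relation : ∀ {u b x₁ x₂ x₀} → InA u -1ℤ 1ℤ b x₁ → InA u -1ℤ 1ℤ b x₂ → x₁ ≢ x₂ → InA u 1ℤ 1ℤ b x₀ →
                       u * (x₁ * x₂) + (1# + u) * x₀ ≡ 0#
    A₁₀-A₀₀-relation {u} {b} {x₁} {x₂} {x₀} x₁∈A₁₀ x₂∈A₁₀ x₁≢x₂ x₀∈A₀₀ =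
      x*y≡0⇒y≡0 1+1≢0 (x*y≡0⇒y≡0 (λ x₁-x₂≡0 → x₁≢x₂ (x-y≡0⇒x≡y x₁-x₂≡0)) (begin
        (x₁ - x₂) * ((1# + 1#) * (u * (x₁ * x₂) + (1# + u) * x₀))
          ≡⟨ solve 4 (λ x₁ x₂ x₀ u →
               (x₁ :- x₂) :* ((con 1ℤ :+ con 1ℤ) :* (u :* (x₁ :* x₂) :+ (con 1ℤ :+ u) :* x₀))
               := x₂ :* Δ₁₀ x₁ u :- x₁ :* Δ₁₀ x₂ u :+ (x₁ :- x₂) :* Δ₀₀ x₀ u) refl x₁ x₂ x₀ u ⟩
        x₂ * δ₁₀ x₁ - x₁ * δ₁₀ x₂ + (x₁ - x₂) * δ₀₀ x₀
          ≡⟨ cong₂ (λ d₁ d₂ → x₂ * d₁ - x₁ * d₂ + (x₁ - x₂) * δ₀₀ x₀) (InA⇒increment x₁∈A₁₀) (InA⇒increment x₂∈A₁₀) ⟩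
        x₂ * b - x₁ * b + (x₁ - x₂) * δ₀₀ x₀
          ≡⟨ cong (λ d₀ → x₂ * b - x₁ * b + (x₁ - x₂) * d₀) (InA⇒increment x₀∈A₀₀) ⟩
        x₂ * b - x₁ * b + (x₁ - x₂) * b
          ≡⟨ solve 3 (λ x₁ x₂ b → x₂ :* b :- x₁ :* b :+ (x₁ :- x₂) :* b := con ℤ.0ℤ) refl x₁ x₂ b ⟩
        0# ∎))
      where
      open ≡-Reasoning
      δ₁₀ δ₀₀ : Carrier → Carrier
      δ₁₀ x = (x + 1#) * (x + 1#) * (1# + u * 1#) - x * x * (1# + u * - 1#)
      δ₀₀ x = (x + 1#) * (x + 1#) * (1# + u * 1#) - x * x * (1# + u * 1#)
      Δ₁₀ Δ₀₀ : ∀ {n} → Polynomial n → Polynomial n → Polynomial n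
      Δ₁₀ x u = (x :+ con 1ℤ) :* (x :+ con 1ℤ) :* (con 1ℤ :+ u :* con 1ℤ) :- x :* x :* (con 1ℤ :+ u :* con -1ℤ)
      Δ₀₀ x u = (x :+ con 1ℤ) :* (x :+ con 1ℤ) :* (con 1ℤ :+ u :* con 1ℤ) :- x :* x :* (con 1ℤ :+ u :* con 1ℤ)

lemma12 : ∀ {q : ℕ} (F : FiniteField q) →
          (∃₂ λ p k → Prime p × ¬ (p ≡ 2) × k ≥ 1 × q ≡ p ^ k) →
          q % 4 ≡ 3 →
          let open FiniteField F in
          ∀ (u : Carrier) → ¬ (u ≡ 0#) → ¬ (u ≡ 1#) → ¬ (u ≡ - 1#) →
          η (1# + u) ≡ η u →
          ∀ (b : Carrier) → #A u -1ℤ 1ℤ b ≡ 2 → #A u 1ℤ 1ℤ b ≡ 0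
lemma12 F _ q%4≡3 u u≢0 _ u≢-1 η[1+u]≡η[u] b #A₁₀≡2 = #A≡0 x₀∉A₀₀
  where
  open FiniteField F
  open FiniteFieldProperties F
  1+u≢0 : 1# + u ≢ 0#
  1+u≢0 1+u≡0 = u≢-1 (x-y≡0⇒x≡y (trans (solve 1 (λ u → u :- (:- con 1ℤ) := con 1ℤ :+ u) refl u) 1+u≡0))
  u[1+u]-QR : QR (u * (1# + u))
  u[1+u]-QR = x*y≢0 u≢0 1+u≢0 , η≡⇒square q%4≡3 u≢0 1+u≢0 (sym η[1+u]≡η[u])
  x₀∉A₀₀ : ∀ x₀ → ¬ InA u 1ℤ 1ℤ b x₀
  x₀∉A₀₀ x₀ x₀∈A₀₀ with x₁ , x₂ , x₁∈A₁₀ , x₂∈A₁₀ , x₁≢x₂ ← #A≡2⇒two-points #A₁₀≡2 =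
    -1-nonsquare q%4≡3 (relation⇒-1-square
      (QNR*QNR-square q%4≡3 (η≡-1⇒QNR (proj₁ x₁∈A₁₀)) (η≡-1⇒QNR (proj₁ x₂∈A₁₀)))
      (η≡1⇒QR (proj₁ x₀∈A₀₀))
      u[1+u]-QR
      (A₁₀-A₀₀-relation q%4≡3 x₁∈A₁₀ x₂∈A₁₀ x₁≢x₂ x₀∈A₀₀))
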